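{- Define $a(1)=1$ and $a(n)=1+\sum_m a(m)$ for $n>1$, and $b(1)=1$ and $b(n)=n+\sum_m b(m)$ for $n>1$, where in both cases the sum runs over all proper divisors $m$ of $n$ (positive divisors $m<n$). Let $A(n)=a(n)/n$ and $B(n)=b(n)/n$. Then for every positive integer $n$, $$B(n)=\frac12+\frac12\sum_{m\mid n}A(m),$$ the sum running over all positive divisors $m$ of $n$.
   Context: $a(n)$ is the number of recursive divisors and $b(n)$ the sum of recursive divisors of $n$. -}

module Defs where

open import Data.Nat using (ℕ; zero; suc; _+_; _*_; _<_; s≤s; z≤n; NonZero)
open import Data.Nat.Properties using (≤-refl; m<n⇒m<1+n)
open import Data.Nat.Divisibility using (_∣_; _∣?_)
open import Data.Nat.Induction using (<-rec)
open import Data.List using (List; []; _∷_; filter; upTo; map)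
open import Data.Rational using (ℚ; 0ℚ) renaming (_+_ to _+ℚ_ ; _/_ to _/ℚ_)
open import Data.Integer using (+_)
open import Relation.Nullary.Decidable using (⌊_⌋)
open import Data.Bool using (if_then_else_)

sumDivBelow : (k n : ℕ) → ((m : ℕ) → m < n → ℕ) → ℕ
sumDivBelow k zero f = 0
sumDivBelow k (suc zero) f = 0
sumDivBelow k (suc (suc j)) f =
  (if ⌊ suc j ∣? k ⌋ then f (suc j) ≤-refl else 0)
  + sumDivBelow k (suc j) (λ m m<1+j → f m (m<n⇒m<1+n m<1+j))

-- The recursion scheme shared by a and b:
-- r(1) = 1 and r(n) = c(n) + Σ_{m ∣ n, 1 ≤ m < n} r(m) for n > 1.
-- (r(0) is irrelevant; we set it to 0.)
divRec : (ℕ → ℕ) → ℕ → ℕ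
divRec c = <-rec (λ _ → ℕ) step
  where
  step : (n : ℕ) → ({m : ℕ} → m < n → ℕ) → ℕ
  step zero _ = 0
  step (suc zero) _ = 1
  step n@(suc (suc _)) rec = c n + sumDivBelow n n (λ m m<n → rec m<n)

a : ℕ → ℕ
a = divRec (λ _ → 1)

b : ℕ → ℕ
b = divRec (λ n → n)

sumℚ : List ℚ → ℚ
sumℚ [] = 0ℚ
sumℚ (x ∷ xs) = x +ℚ sumℚ xs

A : (n : ℕ) → .{{NonZero n}} → ℚ
A n = (+ a n) /ℚ n

B : (n : ℕ) → .{{NonZero n}} → ℚ
B n = (+ b n) /ℚ n

-- Write f ⊛ g for Dirichlet convolution and 1 for the constant function 1. A function R
-- satisfies R(n) = c(n) + ∑_{d ∣ n, d < n} R(d) exactly when R ⊛ 1 + c = 2R, and this recursion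
-- determines R on the positive integers; thus a ⊛ 1 + 1 = 2a and b ⊛ 1 + id = 2b. By associativity
-- and commutativity of ⊛, Y = id + a ⊛ id satisfies
--   Y ⊛ 1 + 2id = 1 ⊛ id + (a ⊛ 1) ⊛ id + 2id = (2a) ⊛ id + 2id = 2Y,
-- so Y and 2b obey the same recursion and coincide: 2b(n) = n + ∑_{m ∣ n} a(m) n/m.
-- Dividing by 2n gives the statement.
module Submission where

open import Defs

module FiniteSums where
  open import Data.Nat
  open import Data.Nat.Properties
  open import Data.Sum using (inj₁; inj₂)
  open import Data.Empty using (⊥-elim)
  open import Function using (_∘_)
  open import Data.Nat.Divisibility using (_∣_; divides; quotient)
  open import Data.Bool using (if_then_else_)
  open import Relation.Nullary using (Dec; yes; no; ¬_; contradiction)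
  open import Relation.Nullary.Decidable using (⌊_⌋)
  open import Relation.Binary.PropositionalEquality
  open import Algebra.Properties.CommutativeSemigroup +-commutativeSemigroup using (interchange)

  -- The index runs over 1, …, N.
  ∑ : ℕ → (ℕ → ℕ) → ℕ
  ∑ zero    f = 0
  ∑ (suc N) f = f (suc N) + ∑ N f

  syntax ∑ N (λ i → e) = ∑[ i ≤ N ] e

  ∑-cong : ∀ N {f g : ℕ → ℕ} → (∀ i → 1 ≤ i → i ≤ N → f i ≡ g i) → ∑ N f ≡ ∑ N g
  ∑-cong zero    f≗g = refl
  ∑-cong (suc N) f≗g =
    cong₂ _+_ (f≗g (suc N) (s≤s z≤n) ≤-refl) (∑-cong N λ i 1≤i i≤N → f≗g i 1≤i (m≤n⇒m≤1+n i≤N))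

  ∑-cong′ : ∀ N {f g : ℕ → ℕ} → (∀ i → f i ≡ g i) → ∑ N f ≡ ∑ N g
  ∑-cong′ N f≗g = ∑-cong N λ i _ _ → f≗g i

  ∑-zero : ∀ N {f : ℕ → ℕ} → (∀ i → 1 ≤ i → i ≤ N → f i ≡ 0) → ∑ N f ≡ 0
  ∑-zero N f≗0 = trans (∑-cong N f≗0) (∑-const0 N)
    where
    ∑-const0 : ∀ N → ∑[ i ≤ N ] 0 ≡ 0
    ∑-const0 zero    = refl
    ∑-const0 (suc N) = ∑-const0 N

  ∑-+ : ∀ N (f g : ℕ → ℕ) → ∑[ i ≤ N ] (f i + g i) ≡ ∑ N f + ∑ N g
  ∑-+ zero    f g = refl
  ∑-+ (suc N) f g =
    trans (cong (f (suc N) + g (suc N) +_) (∑-+ N f g)) (interchange (f (suc N)) (g (suc N)) (∑ N f) (∑ N g))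

  ∑-*ˡ : ∀ N x (f : ℕ → ℕ) → ∑[ i ≤ N ] (x * f i) ≡ x * ∑ N f
  ∑-*ˡ zero    x f = sym (*-zeroʳ x)
  ∑-*ˡ (suc N) x f =
    trans (cong (x * f (suc N) +_) (∑-*ˡ N x f)) (sym (*-distribˡ-+ x (f (suc N)) (∑ N f)))

  ∑-*ʳ : ∀ N x (f : ℕ → ℕ) → ∑[ i ≤ N ] (f i * x) ≡ ∑ N f * x
  ∑-*ʳ N x f = trans (∑-cong′ N λ i → *-comm (f i) x) (trans (∑-*ˡ N x f) (*-comm x (∑ N f)))

  ∑-comm : ∀ N M (f : ℕ → ℕ → ℕ) → ∑[ i ≤ N ] ∑[ j ≤ M ] f i j ≡ ∑[ j ≤ M ] ∑[ i ≤ N ] f i j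
  ∑-comm zero    M f = sym (∑-zero M λ _ _ _ → refl)
  ∑-comm (suc N) M f =
    trans (cong (∑[ j ≤ M ] f (suc N) j +_) (∑-comm N M f)) (sym (∑-+ M (f (suc N)) _))

  ∑-extend : ∀ {m n} (f : ℕ → ℕ) → m ≤ n → (∀ i → m < i → f i ≡ 0) → ∑ n f ≡ ∑ m f
  ∑-extend {n = zero}  f z≤n f≗0 = refl
  ∑-extend {n = suc n} f m≤1+n f≗0 with m≤n⇒m<n∨m≡n m≤1+n
  ... | inj₂ refl   = refl
  ... | inj₁ m<1+n = trans (cong (_+ ∑ n f) (f≗0 (suc n) m<1+n)) (∑-extend f (m<1+n⇒m≤n m<1+n) f≗0)

  ∑-comm-inner : ∀ N M L (f : ℕ → ℕ → ℕ → ℕ) →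
    ∑[ i ≤ N ] ∑[ j ≤ M ] ∑[ k ≤ L ] f i j k ≡ ∑[ i ≤ N ] ∑[ k ≤ L ] ∑[ j ≤ M ] f i j k
  ∑-comm-inner N M L f = ∑-cong′ N λ i → ∑-comm M L (f i)

  ∑-sink³ : ∀ N M L (f : ℕ → ℕ → ℕ → ℕ) →
    ∑[ i ≤ N ] ∑[ j ≤ M ] ∑[ k ≤ L ] f i j k ≡ ∑[ j ≤ M ] ∑[ k ≤ L ] ∑[ i ≤ N ] f i j k
  ∑-sink³ N M L f = trans (∑-comm N M _) (∑-cong′ M λ j → ∑-comm N L λ i k → f i j k)

  ∑-sink⁴ : ∀ N M L K (f : ℕ → ℕ → ℕ → ℕ → ℕ) →
    ∑[ i ≤ N ] ∑[ j ≤ M ] ∑[ k ≤ L ] ∑[ l ≤ K ] f i j k l ≡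
    ∑[ j ≤ M ] ∑[ k ≤ L ] ∑[ l ≤ K ] ∑[ i ≤ N ] f i j k l
  ∑-sink⁴ N M L K f = trans (∑-comm N M _) (∑-cong′ M λ j → ∑-sink³ N L K λ i k l → f i j k l)

  ∑-reverse³ : ∀ N M L (f : ℕ → ℕ → ℕ → ℕ) →
    ∑[ i ≤ N ] ∑[ j ≤ M ] ∑[ k ≤ L ] f i j k ≡ ∑[ k ≤ L ] ∑[ j ≤ M ] ∑[ i ≤ N ] f i j k
  ∑-reverse³ N M L f = begin
    ∑[ i ≤ N ] ∑[ j ≤ M ] ∑[ k ≤ L ] f i j k ≡⟨ ∑-comm-inner N M L f ⟩
    ∑[ i ≤ N ] ∑[ k ≤ L ] ∑[ j ≤ M ] f i j k ≡⟨ ∑-comm N L _ ⟩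
    ∑[ k ≤ L ] ∑[ i ≤ N ] ∑[ j ≤ M ] f i j k ≡⟨ ∑-comm-inner L N M (λ k i j → f i j k) ⟩
    ∑[ k ≤ L ] ∑[ j ≤ M ] ∑[ i ≤ N ] f i j k ∎
    where open ≡-Reasoning

  when : {P : Set} → Dec P → ℕ → ℕ
  when p x = if ⌊ p ⌋ then x else 0

  when-yes : ∀ {P : Set} (p : Dec P) x → P → when p x ≡ x
  when-yes (yes _) x _  = refl
  when-yes (no ¬P) x P = ⊥-elim (¬P P)

  when-no : ∀ {P : Set} (p : Dec P) x → ¬ P → when p x ≡ 0
  when-no (yes P) x ¬P = ⊥-elim (¬P P)
  when-no (no _)  x _  = refl

  when-cong : ∀ {P : Set} (p : Dec P) {x y} → (P → x ≡ y) → when p x ≡ when p y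
  when-cong (yes P) x≡y = x≡y P
  when-cong (no _)  x≡y = refl

  when-⇔ : ∀ {P Q : Set} (p : Dec P) (q : Dec Q) x → (P → Q) → (Q → P) → when p x ≡ when q x
  when-⇔ (yes _) (yes _) x P⇒Q Q⇒P = refl
  when-⇔ (yes P) (no ¬Q) x P⇒Q Q⇒P = ⊥-elim (¬Q (P⇒Q P))
  when-⇔ (no ¬P) (yes Q) x P⇒Q Q⇒P = ⊥-elim (¬P (Q⇒P Q))
  when-⇔ (no _)  (no _)  x P⇒Q Q⇒P = refl

  when-comm : ∀ {P Q : Set} (p : Dec P) (q : Dec Q) x → when p (when q x) ≡ when q (when p x)
  when-comm (yes _) (yes _) x = refl
  when-comm (yes _) (no _)  x = refl
  when-comm (no _)  (yes _) x = refl
  when-comm (no _)  (no _)  x = refl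

  when-+ : ∀ {P : Set} (p : Dec P) x y → when p (x + y) ≡ when p x + when p y
  when-+ (yes _) x y = refl
  when-+ (no _)  x y = refl

  when-*ʳ : ∀ {P : Set} (p : Dec P) x y → when p x * y ≡ when p (x * y)
  when-*ʳ (yes _) x y = refl
  when-*ʳ (no _)  x y = refl

  when-∑ : ∀ {P : Set} (p : Dec P) N (f : ℕ → ℕ) → when p (∑ N f) ≡ ∑[ i ≤ N ] when p (f i)
  when-∑ (yes _) N f = refl
  when-∑ (no _)  N f = sym (∑-zero N λ _ _ _ → refl)

  ∑-when-≟ : ∀ N x (f : ℕ → ℕ) → 1 ≤ x → (N < x → f x ≡ 0) → ∑[ m ≤ N ] when (x ≟ m) (f m) ≡ f x
  ∑-when-≟ zero    x f 1≤x f[x]≡0 = sym (f[x]≡0 1≤x)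
  ∑-when-≟ (suc N) x f 1≤x f[x]≡0 with x ≟ suc N
  ... | yes refl = trans (cong (f x +_) (∑-zero N λ m _ m≤N → when-no (x ≟ m) _ (>⇒≢ (s≤s m≤N))))
                         (+-identityʳ (f x))
  ... | no x≢1+N = ∑-when-≟ N x f 1≤x λ N<x → f[x]≡0 (≤∧≢⇒< N<x (x≢1+N ∘ sym))

  module _ (h : ℕ → ℕ) {i n : ℕ} where

    ∑-when-*≟-divisor : 1 ≤ n → (i∣n : i ∣ n) → ∑[ j ≤ n ] when (i * j ≟ n) (h j) ≡ h (quotient i∣n)
    ∑-when-*≟-divisor 1≤n (divides q n≡q*i) = begin
      ∑[ j ≤ n ] when (i * j ≟ n) (h j)
        ≡⟨ ∑-cong′ n (λ j → when-⇔ (i * j ≟ n) (q ≟ j) (h j) (i*j≡n⇒q≡j j) (q≡j⇒i*j≡n j)) ⟩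
      ∑[ j ≤ n ] when (q ≟ j) (h j)
        ≡⟨ ∑-when-≟ n q h 1≤q (λ n<q → contradiction q≤n (<⇒≱ n<q)) ⟩
      h q ∎
      where
      open ≡-Reasoning
      i≢0 : NonZero i
      i≢0 = ≢-nonZero λ { refl → <⇒≱ 1≤n (≤-reflexive (trans n≡q*i (*-zeroʳ q))) }
      1≤q : 1 ≤ q
      1≤q = n≢0⇒n>0 λ { refl → <⇒≱ 1≤n (≤-reflexive n≡q*i) }
      q≤n : q ≤ n
      q≤n = subst (q ≤_) (sym n≡q*i) (m≤m*n q i {{i≢0}})
      i*j≡n⇒q≡j : ∀ j → i * j ≡ n → q ≡ j
      i*j≡n⇒q≡j j i*j≡n = *-cancelˡ-≡ q j i {{i≢0}} (trans (*-comm i q) (sym (trans i*j≡n n≡q*i)))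
      q≡j⇒i*j≡n : ∀ j → q ≡ j → i * j ≡ n
      q≡j⇒i*j≡n j refl = trans (*-comm i q) (sym n≡q*i)

    ∑-when-*≟-nondivisor : ¬ (i ∣ n) → ∑[ j ≤ n ] when (i * j ≟ n) (h j) ≡ 0
    ∑-when-*≟-nondivisor i∤n = ∑-zero n λ j _ _ → when-no (i * j ≟ n) (h j) λ i*j≡n →
      i∤n (divides j (trans (sym i*j≡n) (*-comm i j)))

module DirichletConvolution where
  open import Data.Nat
  open import Data.Nat.Properties
  open import Data.Nat.Divisibility using (_∣?_; ∣-refl)
  open import Function using (const)
  open import Relation.Nullary using (yes; no)
  open import Relation.Binary.PropositionalEquality
  open FiniteSums

  infixl 7 _⊛_

  _⊛_ : (ℕ → ℕ) → (ℕ → ℕ) → ℕ → ℕ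
  (f ⊛ g) n = ∑[ i ≤ n ] ∑[ j ≤ n ] when (i * j ≟ n) (f i * g j)

  properDivisorSum : (ℕ → ℕ) → ℕ → ℕ
  properDivisorSum f n = ∑[ d ≤ pred n ] when (d ∣? n) (f d)

  ⊛-comm : ∀ f g n → (f ⊛ g) n ≡ (g ⊛ f) n
  ⊛-comm f g n = trans (∑-comm n n _) (∑-cong′ n λ j → ∑-cong′ n λ i →
    trans (when-⇔ (i * j ≟ n) (j * i ≟ n) _ (trans (*-comm j i)) (trans (*-comm i j)))
          (cong (when (j * i ≟ n)) (*-comm (f i) (g j))))

  ⊛-congˡ : ∀ {f f′} g n → (∀ i → 1 ≤ i → i ≤ n → f i ≡ f′ i) → (f ⊛ g) n ≡ (f′ ⊛ g) n
  ⊛-congˡ g n f≗f′ = ∑-cong n λ i 1≤i i≤n → ∑-cong′ n λ j →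
    cong (λ x → when (i * j ≟ n) (x * g j)) (f≗f′ i 1≤i i≤n)

  ⊛-congʳ : ∀ f {g g′} n → (∀ i → 1 ≤ i → i ≤ n → g i ≡ g′ i) → (f ⊛ g) n ≡ (f ⊛ g′) n
  ⊛-congʳ f {g} {g′} n g≗g′ = trans (⊛-comm f g n) (trans (⊛-congˡ f n g≗g′) (⊛-comm g′ f n))

  ⊛-distribʳ-+ : ∀ f f′ g n → ((λ i → f i + f′ i) ⊛ g) n ≡ (f ⊛ g) n + (f′ ⊛ g) n
  ⊛-distribʳ-+ f f′ g n = trans (∑-cong′ n λ i → trans (∑-cong′ n λ j → distrib i j) (∑-+ n _ _)) (∑-+ n _ _)
    where
    distrib : ∀ i j → when (i * j ≟ n) ((f i + f′ i) * g j) ≡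
                      when (i * j ≟ n) (f i * g j) + when (i * j ≟ n) (f′ i * g j)
    distrib i j = trans (cong (when (i * j ≟ n)) (*-distribʳ-+ (g j) (f i) (f′ i))) (when-+ (i * j ≟ n) _ _)

  ⊛-const1 : ∀ f k → (f ⊛ const 1) (suc k) ≡ f (suc k) + properDivisorSum f (suc k)
  ⊛-const1 f k =
    trans (∑-cong (suc k) inner) (cong (_+ properDivisorSum f (suc k)) (when-yes (suc k ∣? suc k) _ ∣-refl))
    where
    inner : ∀ i → 1 ≤ i → i ≤ suc k → ∑[ j ≤ suc k ] when (i * j ≟ suc k) (f i * 1) ≡ when (i ∣? suc k) (f i)
    inner i 1≤i _ with i ∣? suc k
    ... | yes i∣n = trans (∑-when-*≟-divisor (const (f i * 1)) (s≤s z≤n) i∣n) (*-identityʳ (f i))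
    ... | no  i∤n = ∑-when-*≟-nondivisor (const (f i * 1)) i∤n

  ⊛-wide : ∀ f g {m} N → m ≤ N → (f ⊛ g) m ≡ ∑[ i ≤ N ] ∑[ j ≤ N ] when (i * j ≟ m) (f i * g j)
  ⊛-wide f g {m} N m≤N = trans (∑-cong m λ i 1≤i _ → sym (∑-extend _ m≤N (large-j i 1≤i)))
                              (sym (∑-extend _ m≤N large-i))
    where
    large-j : ∀ i → 1 ≤ i → ∀ j → m < j → when (i * j ≟ m) (f i * g j) ≡ 0
    large-j (suc i) _ j m<j = when-no (suc i * j ≟ m) _ (>⇒≢ (<-≤-trans m<j (m≤n*m j (suc i))))
    large-i : ∀ i → m < i → ∑[ j ≤ N ] when (i * j ≟ m) (f i * g j) ≡ 0
    large-i i m<i = ∑-zero N λ { (suc j) _ _ →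
      when-no (i * suc j ≟ m) _ (>⇒≢ (<-≤-trans m<i (m≤m*n i (suc j)))) }

  private
    triple : (f g h : ℕ → ℕ) → ℕ → ℕ
    triple f g h n = ∑[ i ≤ n ] ∑[ j ≤ n ] ∑[ k ≤ n ] when (i * j * k ≟ n) (f i * g j * h k)

    *-reverse³ : ∀ x y z → x * y * z ≡ z * y * x
    *-reverse³ x y z = trans (*-comm (x * y) z) (trans (cong (z *_) (*-comm x y)) (sym (*-assoc z y x)))

    triple-reverse : ∀ f g h n → triple f g h n ≡ triple h g f n
    triple-reverse f g h n = trans (∑-reverse³ n n n _) (∑-cong′ n λ k → ∑-cong′ n λ j → ∑-cong′ n λ i →
      trans (when-⇔ (i * j * k ≟ n) (k * j * i ≟ n) _ (trans (*-reverse³ k j i)) (trans (*-reverse³ i j k)))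
            (cong (when (k * j * i ≟ n)) (*-reverse³ (f i) (g j) (h k))))

    ⊛⊛-triple : ∀ f g h n → ((f ⊛ g) ⊛ h) n ≡ triple f g h n
    ⊛⊛-triple f g h n = begin
      ((f ⊛ g) ⊛ h) n
        ≡⟨ ∑-cong′ n (λ m → ∑-cong n λ k 1≤k _ → expand m k 1≤k) ⟩
      ∑[ m ≤ n ] ∑[ k ≤ n ] ∑[ i ≤ n ] ∑[ j ≤ n ] when (i * j ≟ m) (when (m * k ≟ n) (f i * g j * h k))
        ≡⟨ ∑-sink⁴ n n n n _ ⟩
      ∑[ k ≤ n ] ∑[ i ≤ n ] ∑[ j ≤ n ] ∑[ m ≤ n ] when (i * j ≟ m) (when (m * k ≟ n) (f i * g j * h k))
        ≡⟨ ∑-cong n (λ k 1≤k _ → ∑-cong n λ i 1≤i _ → ∑-cong n λ j 1≤j _ →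
             contract i j k 1≤i 1≤j 1≤k) ⟩
      ∑[ k ≤ n ] ∑[ i ≤ n ] ∑[ j ≤ n ] when (i * j * k ≟ n) (f i * g j * h k)
        ≡⟨ ∑-sink³ n n n _ ⟩
      triple f g h n ∎
      where
      open ≡-Reasoning
      expand : ∀ m k → 1 ≤ k → when (m * k ≟ n) ((f ⊛ g) m * h k) ≡
               ∑[ i ≤ n ] ∑[ j ≤ n ] when (i * j ≟ m) (when (m * k ≟ n) (f i * g j * h k))
      expand m k@(suc _) _ = begin
        when (m * k ≟ n) ((f ⊛ g) m * h k)
          ≡⟨ when-cong (m * k ≟ n) (λ m*k≡n → cong (_* h k) (⊛-wide f g n (subst (m ≤_) m*k≡n (m≤m*n m k)))) ⟩
        when (m * k ≟ n) (∑[ i ≤ n ] ∑[ j ≤ n ] when (i * j ≟ m) (f i * g j) * h k)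
          ≡⟨ cong (when (m * k ≟ n)) (trans (sym (∑-*ʳ n (h k) _)) (∑-cong′ n λ i → sym (∑-*ʳ n (h k) _))) ⟩
        when (m * k ≟ n) (∑[ i ≤ n ] ∑[ j ≤ n ] (when (i * j ≟ m) (f i * g j) * h k))
          ≡⟨ trans (when-∑ (m * k ≟ n) n _) (∑-cong′ n λ i → when-∑ (m * k ≟ n) n _) ⟩
        ∑[ i ≤ n ] ∑[ j ≤ n ] when (m * k ≟ n) (when (i * j ≟ m) (f i * g j) * h k)
          ≡⟨ ∑-cong′ n (λ i → ∑-cong′ n λ j →
               trans (cong (when (m * k ≟ n)) (when-*ʳ (i * j ≟ m) _ _)) (when-comm (m * k ≟ n) (i * j ≟ m) _)) ⟩
        ∑[ i ≤ n ] ∑[ j ≤ n ] when (i * j ≟ m) (when (m * k ≟ n) (f i * g j * h k)) ∎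
      contract : ∀ i j k → 1 ≤ i → 1 ≤ j → 1 ≤ k →
                 ∑[ m ≤ n ] when (i * j ≟ m) (when (m * k ≟ n) (f i * g j * h k)) ≡
                 when (i * j * k ≟ n) (f i * g j * h k)
      contract (suc i) (suc j) k@(suc _) _ _ _ = ∑-when-≟ n (suc i * suc j) _ (s≤s z≤n) λ n<ij →
        when-no (suc i * suc j * k ≟ n) _ (>⇒≢ (<-≤-trans n<ij (m≤m*n (suc i * suc j) k)))

  ⊛-assoc : ∀ f g h n → ((f ⊛ g) ⊛ h) n ≡ (f ⊛ (g ⊛ h)) n
  ⊛-assoc f g h n = begin
    ((f ⊛ g) ⊛ h) n ≡⟨ ⊛⊛-triple f g h n ⟩
    triple f g h n  ≡⟨ triple-reverse f g h n ⟩
    triple h g f n  ≡⟨ ⊛⊛-triple h g f n ⟨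
    ((h ⊛ g) ⊛ f) n ≡⟨ ⊛-comm (h ⊛ g) f n ⟩
    (f ⊛ (h ⊛ g)) n ≡⟨ ⊛-congʳ f n (λ i _ _ → ⊛-comm h g i) ⟩
    (f ⊛ (g ⊛ h)) n ∎
    where open ≡-Reasoning

  ⊛-right-comm : ∀ f g h n → ((f ⊛ g) ⊛ h) n ≡ ((f ⊛ h) ⊛ g) n
  ⊛-right-comm f g h n = begin
    ((f ⊛ g) ⊛ h) n ≡⟨ ⊛-assoc f g h n ⟩
    (f ⊛ (g ⊛ h)) n ≡⟨ ⊛-congʳ f n (λ i _ _ → ⊛-comm g h i) ⟩
    (f ⊛ (h ⊛ g)) n ≡⟨ ⊛-assoc f h g n ⟨
    ((f ⊛ h) ⊛ g) n ∎
    where open ≡-Reasoning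

module DivisorRecursion where
  open import Data.Nat
  open import Data.Nat.Properties
  open import Data.Nat.Divisibility using (_∣?_)
  open import Data.Nat.Induction using (<-wellFounded; <′-wellFounded′; <-rec)
  open import Data.Product using (Σ; _,_; proj₁)
  open import Data.Bool using (if_then_else_)
  open import Relation.Nullary.Decidable using (⌊_⌋)
  open import Induction.WellFounded using (module Some; module Subrelation; module FixPoint)
  open import Function using (const)
  open import Relation.Binary.PropositionalEquality
  open import Algebra.Properties.CommutativeSemigroup +-commutativeSemigroup using (interchange)
  open FiniteSums
  open DirichletConvolution

  sumDivBelow-cong : ∀ k n {f g : (m : ℕ) → m < n → ℕ} → (∀ m m<n → f m m<n ≡ g m m<n) →
    sumDivBelow k n f ≡ sumDivBelow k n g
  sumDivBelow-cong k zero          f≗g = refl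
  sumDivBelow-cong k (suc zero)    f≗g = refl
  sumDivBelow-cong k (suc (suc j)) f≗g =
    cong₂ _+_ (cong (when (suc j ∣? k)) (f≗g (suc j) ≤-refl)) (sumDivBelow-cong k (suc j) λ m m<n → f≗g m _)

  sumDivBelow-∑ : ∀ k N (f : ℕ → ℕ) → sumDivBelow k (suc N) (λ m _ → f m) ≡ ∑[ d ≤ N ] when (d ∣? k) (f d)
  sumDivBelow-∑ k zero    f = refl
  sumDivBelow-∑ k (suc N) f = cong (when (suc N ∣? k) (f (suc N)) +_) (sumDivBelow-∑ k N f)

  private
    Step : Set
    Step = (n : ℕ) → ({m : ℕ} → m < n → ℕ) → ℕ

    -- divRec c is <-rec applied to a step function that is local to Defs; it is
    -- recovered by unification against an accessibility proof that does not reduce.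
    divRec-step : (c : ℕ → ℕ) → Σ Step λ s → ∀ j → Σ ℕ λ r → divRec c (3 + j) ≡
      c (3 + j) + ((if ⌊ 2 + j ∣? 3 + j ⌋ then c (2 + j) + sumDivBelow (2 + j) (2 + j)
        (λ _ → Some.wfRecBuilder (λ _ → ℕ) s (2 + j)
                 (Subrelation.accessible <⇒<′ (<′-wellFounded′ (3 + j) (<⇒<′ ≤-refl))))
        else 0) + r)
    divRec-step c = _ , λ j → _ , refl

  divRec-unfold : ∀ c j → divRec c (2 + j) ≡ c (2 + j) + sumDivBelow (2 + j) (2 + j) (λ m _ → divRec c m)
  divRec-unfold c j = FixPoint.unfold-wfRec <-wellFounded (λ _ → ℕ) (proj₁ (divRec-step c)) step-ext
    where
    step-ext : (n : ℕ) {IH IH′ : ∀ {m} → m < n → ℕ} → (∀ {m} m<n → IH {m} m<n ≡ IH′ m<n) →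
               proj₁ (divRec-step c) n IH ≡ proj₁ (divRec-step c) n IH′
    step-ext zero          IH≗IH′ = refl
    step-ext (suc zero)    IH≗IH′ = refl
    step-ext (suc (suc j)) IH≗IH′ = cong (c (2 + j) +_) (sumDivBelow-cong _ _ λ m m<n → IH≗IH′ m<n)

  DivRecursion : (c R : ℕ → ℕ) → Set
  DivRecursion c R = ∀ k → R (suc k) ≡ c (suc k) + properDivisorSum R (suc k)

  divRec-recursion : ∀ c → c 1 ≡ 1 → DivRecursion c (divRec c)
  divRec-recursion c c[1]≡1 zero    = sym (trans (+-identityʳ (c 1)) c[1]≡1)
  divRec-recursion c c[1]≡1 (suc j) =
    trans (divRec-unfold c j) (cong (c (2 + j) +_) (sumDivBelow-∑ (2 + j) (suc j) (divRec c)))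

  DivRecursion-unique : ∀ {c R S} → DivRecursion c R → DivRecursion c S → ∀ k → R (suc k) ≡ S (suc k)
  DivRecursion-unique {c} {R} {S} recR recS = <-rec _ λ k IH → begin
    R (suc k)                             ≡⟨ recR k ⟩
    c (suc k) + properDivisorSum R (suc k) ≡⟨ cong (c (suc k) +_) (∑-cong k λ { (suc d) _ d<k →
                                                 when-cong (suc d ∣? suc k) λ _ → IH d<k }) ⟩
    c (suc k) + properDivisorSum S (suc k) ≡⟨ recS k ⟨
    S (suc k)                             ∎
    where open ≡-Reasoning

  DivRecursion-+ : ∀ {c c′ R R′} → DivRecursion c R → DivRecursion c′ R′ →
                   DivRecursion (λ n → c n + c′ n) (λ n → R n + R′ n)
  DivRecursion-+ {c} {c′} {R} {R′} recR recR′ k = begin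
    R (suc k) + R′ (suc k)
      ≡⟨ cong₂ _+_ (recR k) (recR′ k) ⟩
    (c (suc k) + properDivisorSum R (suc k)) + (c′ (suc k) + properDivisorSum R′ (suc k))
      ≡⟨ interchange (c (suc k)) _ _ _ ⟩
    (c (suc k) + c′ (suc k)) + (properDivisorSum R (suc k) + properDivisorSum R′ (suc k))
      ≡⟨ cong (c (suc k) + c′ (suc k) +_) (sym (trans (∑-cong′ k λ d → when-+ (d ∣? suc k) _ _) (∑-+ k _ _))) ⟩
    (c (suc k) + c′ (suc k)) + properDivisorSum (λ n → R n + R′ n) (suc k) ∎
    where open ≡-Reasoning

  DivRecursion⇒⊛-const1 : ∀ c R → DivRecursion c R → ∀ k →
                          (R ⊛ const 1) (suc k) + c (suc k) ≡ R (suc k) + R (suc k)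
  DivRecursion⇒⊛-const1 c R recR k = begin
    (R ⊛ const 1) (suc k) + c (suc k)                   ≡⟨ cong (_+ c (suc k)) (⊛-const1 R k) ⟩
    R (suc k) + properDivisorSum R (suc k) + c (suc k)   ≡⟨ +-assoc (R (suc k)) _ _ ⟩
    R (suc k) + (properDivisorSum R (suc k) + c (suc k)) ≡⟨ cong (R (suc k) +_) (+-comm _ (c (suc k))) ⟩
    R (suc k) + (c (suc k) + properDivisorSum R (suc k)) ≡⟨ cong (R (suc k) +_) (recR k) ⟨
    R (suc k) + R (suc k)                               ∎
    where open ≡-Reasoning

  ⊛-const1⇒DivRecursion : ∀ c R → (∀ k → (R ⊛ const 1) (suc k) + c (suc k) ≡ R (suc k) + R (suc k)) →
                          DivRecursion c R
  ⊛-const1⇒DivRecursion c R eq k = sym (+-cancelˡ-≡ (R (suc k)) _ _ (begin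
    R (suc k) + (c (suc k) + properDivisorSum R (suc k)) ≡⟨ cong (R (suc k) +_) (+-comm (c (suc k)) _) ⟩
    R (suc k) + (properDivisorSum R (suc k) + c (suc k)) ≡⟨ +-assoc (R (suc k)) _ _ ⟨
    R (suc k) + properDivisorSum R (suc k) + c (suc k)   ≡⟨ cong (_+ c (suc k)) (⊛-const1 R k) ⟨
    (R ⊛ const 1) (suc k) + c (suc k)                   ≡⟨ eq k ⟩
    R (suc k) + R (suc k)                               ∎))
    where open ≡-Reasoning

module RecursiveDivisorFunctions where
  open import Data.Nat
  open import Data.Nat.Properties
  open import Function using (id; const)
  open import Relation.Binary.PropositionalEquality
  open import Algebra.Properties.CommutativeSemigroup +-commutativeSemigroup using (interchange)
  open DirichletConvolution
  open DivisorRecursion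

  module _ {R : ℕ → ℕ} (recR : DivRecursion (const 1) R) where

    ⊛id-double : ∀ n → (R ⊛ id) n + (R ⊛ id) n ≡ ((R ⊛ const 1) ⊛ id) n + (const 1 ⊛ id) n
    ⊛id-double n = begin
      (R ⊛ id) n + (R ⊛ id) n                   ≡⟨ ⊛-distribʳ-+ R R id n ⟨
      ((λ i → R i + R i) ⊛ id) n                ≡⟨ ⊛-congˡ id n double-R ⟨
      ((λ i → (R ⊛ const 1) i + 1) ⊛ id) n      ≡⟨ ⊛-distribʳ-+ (R ⊛ const 1) (const 1) id n ⟩
      ((R ⊛ const 1) ⊛ id) n + (const 1 ⊛ id) n ∎
      where
      open ≡-Reasoning
      double-R : ∀ i → 1 ≤ i → i ≤ n → (R ⊛ const 1) i + 1 ≡ R i + R i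
      double-R (suc i) _ _ = DivRecursion⇒⊛-const1 (const 1) R recR i

    id+⊛id-recursion : DivRecursion (λ n → n + n) (λ n → n + (R ⊛ id) n)
    id+⊛id-recursion = ⊛-const1⇒DivRecursion (λ n → n + n) Y Y⊛const1
      where
      Y : ℕ → ℕ
      Y n = n + (R ⊛ id) n
      Y⊛const1 : ∀ k → (Y ⊛ const 1) (suc k) + (suc k + suc k) ≡ Y (suc k) + Y (suc k)
      Y⊛const1 k = let n = suc k in begin
        (Y ⊛ const 1) n + (n + n)
          ≡⟨ cong (_+ (n + n)) (⊛-distribʳ-+ id (R ⊛ id) (const 1) n) ⟩
        ((id ⊛ const 1) n + ((R ⊛ id) ⊛ const 1) n) + (n + n)
          ≡⟨ cong (_+ (n + n)) (cong₂ _+_ (⊛-comm id (const 1) n) (⊛-right-comm R id (const 1) n)) ⟩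
        ((const 1 ⊛ id) n + ((R ⊛ const 1) ⊛ id) n) + (n + n)
          ≡⟨ trans (+-comm _ (n + n)) (cong ((n + n) +_) (+-comm ((const 1 ⊛ id) n) _)) ⟩
        (n + n) + (((R ⊛ const 1) ⊛ id) n + (const 1 ⊛ id) n)
          ≡⟨ cong ((n + n) +_) (⊛id-double n) ⟨
        (n + n) + ((R ⊛ id) n + (R ⊛ id) n)
          ≡⟨ interchange n n _ _ ⟩
        Y n + Y n ∎
        where open ≡-Reasoning

  b-double : ∀ k → b (suc k) + b (suc k) ≡ suc k + (a ⊛ id) (suc k)
  b-double = DivRecursion-unique {λ n → n + n} {λ n → b n + b n} {λ n → n + (a ⊛ id) n}
    (DivRecursion-+ {id} {id} {b} {b} b-recursion b-recursion) (id+⊛id-recursion a-recursion)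
    where
    a-recursion : DivRecursion (const 1) a
    a-recursion = divRec-recursion (const 1) refl
    b-recursion : DivRecursion id b
    b-recursion = divRec-recursion id refl

module Fractions where
  open import Data.Nat as ℕ using (ℕ; suc; NonZero)
  open import Data.Nat.Solver using (module +-*-Solver)
  import Data.Integer as ℤ
  open import Data.Integer using (+_)
  import Data.Integer.Properties as ℤ
  open import Data.Rational using (_/_; _+_; _*_; ½)
  open import Data.Rational.Properties
    using (fromℚᵘ-cong; toℚᵘ-injective; toℚᵘ-fromℚᵘ; toℚᵘ-homo-+; toℚᵘ-homo-*)
  open import Data.Rational.Unnormalised using (mkℚᵘ; *≡*)
  import Data.Rational.Unnormalised.Properties as ℚᵘ
  open import Relation.Binary.PropositionalEquality
  open +-*-Solver

  /-cross : ∀ x y d e .{{_ : NonZero d}} .{{_ : NonZero e}} → x ℕ.* e ≡ y ℕ.* d → (+ x) / d ≡ (+ y) / e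
  /-cross x y (suc d) (suc e) x*e≡y*d = fromℚᵘ-cong {mkℚᵘ (+ x) d} {mkℚᵘ (+ y) e} (*≡* (begin
    + x ℤ.* + suc e   ≡⟨ ℤ.pos-* x (suc e) ⟨
    + (x ℕ.* suc e)   ≡⟨ cong +_ x*e≡y*d ⟩
    + (y ℕ.* suc d)   ≡⟨ ℤ.pos-* y (suc d) ⟩
    + y ℤ.* + suc d   ∎))
    where open ≡-Reasoning

  +-/ : ∀ x y d e → (+ x) / suc d + (+ y) / suc e ≡ (+ (x ℕ.* suc e ℕ.+ y ℕ.* suc d)) / (suc d ℕ.* suc e)
  +-/ x y d e = toℚᵘ-injective (ℚᵘ.≃-trans (toℚᵘ-homo-+ ((+ x) / suc d) ((+ y) / suc e))
    (ℚᵘ.≃-trans (ℚᵘ.+-cong (toℚᵘ-fromℚᵘ (mkℚᵘ (+ x) d)) (toℚᵘ-fromℚᵘ (mkℚᵘ (+ y) e)))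
    (ℚᵘ.≃-trans (ℚᵘ.≃-reflexive (cong (λ z → mkℚᵘ z _) numerator)) (ℚᵘ.≃-sym (toℚᵘ-fromℚᵘ _)))))
    where
    numerator : + x ℤ.* + suc e ℤ.+ + y ℤ.* + suc d ≡ + (x ℕ.* suc e ℕ.+ y ℕ.* suc d)
    numerator = sym (trans (ℤ.pos-+ (x ℕ.* suc e) _) (cong₂ ℤ._+_ (ℤ.pos-* x (suc e)) (ℤ.pos-* y (suc d))))

  *-/ : ∀ x y d e → ((+ x) / suc d) * ((+ y) / suc e) ≡ (+ (x ℕ.* y)) / (suc d ℕ.* suc e)
  *-/ x y d e = toℚᵘ-injective (ℚᵘ.≃-trans (toℚᵘ-homo-* ((+ x) / suc d) ((+ y) / suc e))
    (ℚᵘ.≃-trans (ℚᵘ.*-cong (toℚᵘ-fromℚᵘ (mkℚᵘ (+ x) d)) (toℚᵘ-fromℚᵘ (mkℚᵘ (+ y) e)))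
    (ℚᵘ.≃-trans (ℚᵘ.≃-reflexive (cong (λ z → mkℚᵘ z _) (sym (ℤ.pos-* x y)))) (ℚᵘ.≃-sym (toℚᵘ-fromℚᵘ _)))))

  +-/-same : ∀ x y d → (+ x) / suc d + (+ y) / suc d ≡ (+ (x ℕ.+ y)) / suc d
  +-/-same x y d = trans (+-/ x y d d) (/-cross (x ℕ.* suc d ℕ.+ y ℕ.* suc d) (x ℕ.+ y) (suc d ℕ.* suc d) (suc d)
    (solve 3 (λ x y n → (x :* n :+ y :* n) :* n := (x :+ y) :* (n :* n)) refl x y (suc d)))

  half-of-double : ∀ x y k → x ℕ.+ x ≡ suc k ℕ.+ y → (+ x) / suc k ≡ ½ + ½ * ((+ y) / suc k)
  half-of-double x y k x+x≡n+y = begin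
    (+ x) / n
      ≡⟨ /-cross x (1 ℕ.* (2 ℕ.* n) ℕ.+ 1 ℕ.* y ℕ.* 2) n (2 ℕ.* (2 ℕ.* n)) cross ⟩
    (+ (1 ℕ.* (2 ℕ.* n) ℕ.+ 1 ℕ.* y ℕ.* 2)) / (2 ℕ.* (2 ℕ.* n))
      ≡⟨ +-/ 1 (1 ℕ.* y) 1 _ ⟨
    ½ + (+ (1 ℕ.* y)) / (2 ℕ.* n)
      ≡⟨ cong (λ q → ½ + q) (*-/ 1 y 1 k) ⟨
    ½ + ½ * ((+ y) / n) ∎
    where
    open ≡-Reasoning
    n = suc k
    cross : x ℕ.* (2 ℕ.* (2 ℕ.* n)) ≡ (1 ℕ.* (2 ℕ.* n) ℕ.+ 1 ℕ.* y ℕ.* 2) ℕ.* n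
    cross = begin
      x ℕ.* (2 ℕ.* (2 ℕ.* n))
        ≡⟨ solve 2 (λ x n → x :* (con 2 :* (con 2 :* n)) := (x :+ x) :* (con 2 :* n)) refl x n ⟩
      (x ℕ.+ x) ℕ.* (2 ℕ.* n)
        ≡⟨ cong (ℕ._* (2 ℕ.* n)) x+x≡n+y ⟩
      (n ℕ.+ y) ℕ.* (2 ℕ.* n)
        ≡⟨ solve 2 (λ n y → (n :+ y) :* (con 2 :* n) := (con 1 :* (con 2 :* n) :+ con 1 :* y :* con 2) :* n) refl n y ⟩
      (1 ℕ.* (2 ℕ.* n) ℕ.+ 1 ℕ.* y ℕ.* 2) ℕ.* n ∎

module RationalDivisorSums where
  open import Data.Nat as ℕ using (ℕ; suc; _≟_)
  import Data.Nat.Properties as ℕ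
  open import Data.Nat.Divisibility using (_∣_; _∣?_; divides)
  open import Data.Integer using (+_)
  open import Data.List using ([]; _∷_; [_]; _++_; map; filter; upTo)
  open import Data.List.Properties using (upTo-∷ʳ; filter-++; map-++)
  open import Data.Rational using (ℚ; _/_; _+_)
  open import Data.Rational.Properties using (+-identityˡ; +-identityʳ; +-assoc; 0/n≡0)
  open import Function using (id; _∘_)
  open import Relation.Nullary using (yes; no; ¬_)
  open import Relation.Unary using (Decidable)
  open import Relation.Binary.PropositionalEquality hiding ([_])
  open FiniteSums
  open DirichletConvolution
  open Fractions

  sumℚ-++ : ∀ xs ys → sumℚ (xs ++ ys) ≡ sumℚ xs + sumℚ ys
  sumℚ-++ []       ys = sym (+-identityˡ (sumℚ ys))
  sumℚ-++ (x ∷ xs) ys = trans (cong (λ q → x + q) (sumℚ-++ xs ys)) (sym (+-assoc x (sumℚ xs) (sumℚ ys)))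

  module _ {P : ℕ → Set} (P? : Decidable P) (f : ℕ → ℚ) (g : ℕ → ℕ) (d : ℕ)
           (f≡g/d : ∀ m → P m → f m ≡ (+ g (suc m)) / suc d) (g≡0 : ∀ m → ¬ P m → g (suc m) ≡ 0) where

    sumℚ-filter-singleton : ∀ m → sumℚ (map f (filter P? [ m ])) ≡ (+ g (suc m)) / suc d
    sumℚ-filter-singleton m with P? m
    ... | yes Pm = trans (+-identityʳ (f m)) (f≡g/d m Pm)
    ... | no ¬Pm = trans (sym (0/n≡0 (suc d))) (cong (λ z → (+ z) / suc d) (sym (g≡0 m ¬Pm)))

    sumℚ-filter-upTo : ∀ M → sumℚ (map f (filter P? (upTo M))) ≡ (+ ∑ M g) / suc d
    sumℚ-filter-upTo ℕ.zero    = sym (0/n≡0 (suc d))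
    sumℚ-filter-upTo (suc M) = begin
      sumℚ (map f (filter P? (upTo (suc M))))
        ≡⟨ cong (sumℚ ∘ map f ∘ filter P?) (upTo-∷ʳ M) ⟨
      sumℚ (map f (filter P? (upTo M ++ [ M ])))
        ≡⟨ cong sumℚ (trans (cong (map f) (filter-++ P? (upTo M) [ M ]))
                            (map-++ f (filter P? (upTo M)) (filter P? [ M ]))) ⟩
      sumℚ (map f (filter P? (upTo M)) ++ map f (filter P? [ M ]))
        ≡⟨ sumℚ-++ (map f (filter P? (upTo M))) _ ⟩
      sumℚ (map f (filter P? (upTo M))) + sumℚ (map f (filter P? [ M ]))
        ≡⟨ cong₂ _+_ (sumℚ-filter-upTo M) (sumℚ-filter-singleton M) ⟩
      (+ ∑ M g) / suc d + (+ g (suc M)) / suc d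
        ≡⟨ +-/-same (∑ M g) (g (suc M)) d ⟩
      (+ (∑ M g ℕ.+ g (suc M))) / suc d
        ≡⟨ cong (λ z → (+ z) / suc d) (ℕ.+-comm (∑ M g) (g (suc M))) ⟩
      (+ ∑ (suc M) g) / suc d ∎
      where open ≡-Reasoning

  sumℚ-divisors-A : ∀ k → sumℚ (map (λ m → A (suc m)) (filter (λ m → suc m ∣? suc k) (upTo (suc k)))) ≡
                          (+ (a ⊛ id) (suc k)) / suc k
  sumℚ-divisors-A k =
    sumℚ-filter-upTo (λ m → suc m ∣? suc k) (λ m → A (suc m)) summand k divisor nondivisor (suc k)
    where
    summand : ℕ → ℕ
    summand i = ∑[ j ≤ suc k ] when (i ℕ.* j ≟ suc k) (a i ℕ.* j)
    divisor : ∀ m → (d : suc m ∣ suc k) → A (suc m) ≡ (+ summand (suc m)) / suc k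
    divisor m d@(divides q n≡q*i) = trans
      (/-cross (a (suc m)) (a (suc m) ℕ.* q) (suc m) (suc k)
        (trans (cong (a (suc m) ℕ.*_) n≡q*i) (sym (ℕ.*-assoc (a (suc m)) q (suc m)))))
      (cong (λ z → (+ z) / suc k) (sym (∑-when-*≟-divisor (a (suc m) ℕ.*_) (ℕ.s≤s ℕ.z≤n) d)))
    nondivisor : ∀ m → ¬ (suc m ∣ suc k) → summand (suc m) ≡ 0
    nondivisor m = ∑-when-*≟-nondivisor (a (suc m) ℕ.*_)

open import Data.Nat using (ℕ; suc)
open import Data.List using (map; upTo; filter)
open import Data.Nat.Divisibility using (_∣?_)
open import Data.Integer using (+_)
open import Data.Rational using (_/_; _+_; _*_; ½)
open import Relation.Binary.PropositionalEquality using (_≡_; cong; sym; module ≡-Reasoning)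
open import Function using (id)
open DirichletConvolution using (_⊛_)
open RecursiveDivisorFunctions using (b-double)
open Fractions using (half-of-double)
open RationalDivisorSums using (sumℚ-divisors-A)

theorem2 : (k : ℕ) →
    B (suc k) ≡ ½ + ½ * sumℚ (map (λ m → A (suc m)) (filter (λ m → suc m ∣? suc k) (upTo (suc k))))
theorem2 k = begin
  B (suc k)                                  ≡⟨ half-of-double (b (suc k)) ((a ⊛ id) (suc k)) k (b-double k) ⟩
  ½ + ½ * ((+ (a ⊛ id) (suc k)) / suc k)     ≡⟨ cong (λ q → ½ + ½ * q) (sym (sumℚ-divisors-A k)) ⟩
  ½ + ½ * sumℚ (map (λ m → A (suc m)) (filter (λ m → suc m ∣? suc k) (upTo (suc k)))) ∎
  where open ≡-Reasoning
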